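{- Let $D$ be a composition tableau (ComT), $k$ a positive integer, and $D'=k\to D$ the result of skyline insertion of $k$ into $D$. Let row $i$ of $D'$ be the row augmented by the insertion. Then for every row $r>i$ of $D'$, the length of row $i$ of $D'$ differs from the length of row $r$ of $D'$.
   Context: ComTs. For a composition $\alpha=(\alpha_1,\dots,\alpha_\ell)$ (positive parts) with largest part $m$, a composition tableau of shape $\alpha$ is a filling of the left-justified diagram with $\alpha_i$ cells in row $i$ (rows numbered from the top) by positive integers such that rows weakly decrease left to right, the leftmost column strictly increases top to bottom, and, padding rows with $0$'s to an $\ell\times m$ array $\hat T$, for all $1\le i<j\le\ell$, $2\le k\le m$: $\hat T(j,k)\ne0$ and $\hat T(j,k)\ge\hat T(i,k)$ imply $\hat T(j,k)>\hat T(i,k-1)$. Skyline insertion $k_1\to F$ into a ComT $F$ whose longest row has length $r$: scan column positions, starting at the top position of column $j=r+1$. (1) If the current position is empty and is at the end of a row of length $j-1$, and the current value $k_1$ is weakly less than the last entry of that row, place $k_1$ in this empty position and stop. Otherwise, if the position is nonempty and contains $k_2<k_1$, and $k_1$ is weakly less than the entry immediately left of $k_2$, then $k_1$ bumps $k_2$: put $k_1$ in this position and make $k_2$ the current value. (2) With the (possibly new) current value, continue scanning successive positions of the column from top to bottom as in (1), bumping whenever possible, and then continue at the top of the next column to the left (decrement $j$). (3) If an element is bumped into the first column (i.e. the scan passes column 2 without stopping), create a new row consisting of one cell containing that element, placed so that the first column is strictly increasing top to bottom, and stop. The final cell filled is the new cell, and the row of the resulting tableau containing it is called the row augmented by the insertion.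 -}

module Defs where

open import Data.Nat using (ℕ; zero; suc; _+_; _∸_; _≤_; _<_; _⊔_; _≤ᵇ_; _<ᵇ_; _≡ᵇ_)
open import Data.Bool using (Bool; true; false; if_then_else_; _∧_)
open import Data.List using (List; []; _∷_; length; foldr; [_]; _++_)
open import Data.Product using (_×_; _,_; proj₁; proj₂)
open import Data.Sum using (_⊎_; inj₁; inj₂)
open import Data.List.Relation.Unary.All using (All)
open import Relation.Binary.PropositionalEquality using (_≡_; _≢_)

-- A (partial) filling of a left-justified diagram: a list of rows, listed
-- top to bottom; each row is the list of its entries, left to right.
Row : Set
Row = List ℕ

Tab : Set
Tab = List Row

-- Safe lookup with default 0 (this is the zero-padding of the paper's T̂).
nth : List ℕ → ℕ → ℕ
nth []       _       = 0
nth (x ∷ xs) zero    = x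
nth (x ∷ xs) (suc n) = nth xs n

rowAt : Tab → ℕ → Row
rowAt []       _       = []
rowAt (r ∷ rs) zero    = r
rowAt (r ∷ rs) (suc n) = rowAt rs n

-- Padded entry T̂(i,c): row i, column c, both 0-indexed (0 if no cell).
entry : Tab → ℕ → ℕ → ℕ
entry T i c = nth (rowAt T i) c

rowLen : Tab → ℕ → ℕ
rowLen T i = length (rowAt T i)

maxLen : Tab → ℕ
maxLen = foldr (λ r acc → length r ⊔ acc) 0

-- Composition tableau (ComT).  Indices are 0-indexed: row i here is row i+1
-- of the paper, column c here is column c+1 of the paper.
record IsComT (T : Tab) : Set where
  field
    rowsNonempty : All (λ r → 1 ≤ length r) T
    positive     : All (All (λ x → 1 ≤ x)) T
    rowsWeaklyDecreasing :
      ∀ i c → i < length T → suc c < rowLen T i → entry T i (suc c) ≤ entry T i c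
    firstColStrictlyIncreasing :
      ∀ i → suc i < length T → entry T i 0 < entry T (suc i) 0
    -- triple rule: paper's i<j rows, column k (2 ≤ k ≤ m) is our column suc c
    tripleRule :
      ∀ i j c → i < j → j < length T → suc c < maxLen T →
      entry T j (suc c) ≢ 0 →
      entry T i (suc c) ≤ entry T j (suc c) →
      entry T i c < entry T j (suc c)

setAt : List ℕ → ℕ → ℕ → List ℕ
setAt []       _       _ = []
setAt (x ∷ xs) zero    v = v ∷ xs
setAt (x ∷ xs) (suc n) v = x ∷ setAt xs n v

-- Outcome of scanning a column: either the insertion stopped (resulting
-- tableau, index of the row containing the new cell), or it continues with
-- the modified tableau and the current value.
ScanResult : Set
ScanResult = (Tab × ℕ) ⊎ (Tab × ℕ)

-- Scan (paper's) column j ≥ 2 top to bottom with current value v.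
-- In 0-indexed terms the position is column j-1, its left neighbour j-2.
scanCol : ℕ → ℕ → Tab → ScanResult
scanCol j v [] = inj₂ ([] , v)
scanCol j v (row ∷ rest) =
  if (length row ≡ᵇ j ∸ 1) ∧ (v ≤ᵇ nth row (j ∸ 2))
  then inj₁ ((row ++ [ v ]) ∷ rest , 0)
  else (if (j ≤ᵇ length row) ∧ (nth row (j ∸ 1) <ᵇ v) ∧ (v ≤ᵇ nth row (j ∸ 2))
        then continue (setAt row (j ∸ 1) v) (scanCol j (nth row (j ∸ 1)) rest)
        else continue row (scanCol j v rest))
  where
  continue : Row → ScanResult → ScanResult
  continue r (inj₁ (T , i)) = inj₁ (r ∷ T , suc i)
  continue r (inj₂ (T , w)) = inj₂ (r ∷ T , w)

-- Create a new one-cell row [v], placed so that the first column increases: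
-- it goes directly before the first row whose first entry is ≥ v.
insertNewRow : ℕ → Tab → Tab × ℕ
insertNewRow v [] = ([ v ] ∷ [] , 0)
insertNewRow v (row ∷ rest) =
  if nth row 0 <ᵇ v
  then (row ∷ proj₁ (insertNewRow v rest) , suc (proj₂ (insertNewRow v rest)))
  else ([ v ] ∷ row ∷ rest , 0)

-- scanCols n v T scans columns n+1, n, …, 2 (paper's numbering), then
-- creates a new row if no stop occurred.
scanCols : ℕ → ℕ → Tab → Tab × ℕ
scanCols zero    v T = insertNewRow v T
scanCols (suc n) v T with scanCol (suc (suc n)) v T
... | inj₁ res       = res
... | inj₂ (T' , w)  = scanCols n w T'

-- Skyline insertion k → D: returns the resulting tableau D' together with
-- the (0-indexed) index of the row augmented by the insertion.
skylineInsert : ℕ → Tab → Tab × ℕ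
skylineInsert k D = scanCols (maxLen D) k D

module Submission where

-- Skyline insertion scans the columns from right to left.  Write c+1 for the
-- (0-indexed) column being scanned and v for the current value.  The heart
-- of the proof is the invariant
--   (LastBelow)  every row ending in column c+1 has its last entry < v,
-- kept together with positivity, the first-column order and the triple rule
-- in the columns ≤ c; the latter survive a scan because it only changes
-- column c+1.
--   * If v stops at the end of a row x of length c+1 (so v ≤ x(c)), a row y
--     further down of length c+2 would give x(c) < y(c+1) < v ≤ x(c) by the
--     triple rule and LastBelow: impossible.
--   * If v reaches the first column, the new row [v] goes above every row
--     with first entry ≥ v, while LastBelow says the rows of length 1 have
--     entry < v.
--   * LastBelow is re-established for column c: the value leaving column c+1
--     is the entering value or an entry bumped from a row further down, and
--     by the triple rule it exceeds the last entry of every row of length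
--     c+1 that the scan passed.

open import Defs
open import Data.Nat using (ℕ; zero; suc; _≤_; _<_; _≤ᵇ_; _<ᵇ_; _≡ᵇ_; z≤n; s≤s; _<?_)
open import Data.Nat.Properties
open import Data.Bool using (true; false; T; _∧_)
open import Data.Bool.Properties using (T-≡; T-∧)
open import Data.Empty using (⊥; ⊥-elim)
open import Data.List using (List; []; _∷_; length; [_]; _++_)
open import Data.List.Properties using (length-++)
open import Data.List.Relation.Unary.All using (All; []; _∷_)
import Data.List.Relation.Unary.All as All
open import Data.List.Relation.Unary.Any using (Any; here; there)
import Data.List.Relation.Unary.Any as Any
open import Data.List.Relation.Unary.AllPairs using (AllPairs; []; _∷_)
open import Data.List.Relation.Unary.Linked using (Linked; []; [-]; _∷_)
open import Data.List.Relation.Unary.Linked.Properties using (Linked⇒AllPairs)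
open import Data.List.Relation.Binary.Pointwise using (Pointwise; []; _∷_)
open import Data.Product using (_×_; _,_; proj₁; proj₂)
open import Data.Sum using (_⊎_; inj₁; inj₂)
open import Function.Bundles using (Equivalence)
open import Relation.Nullary using (yes; no)
open import Relation.Binary.PropositionalEquality
  using (_≡_; _≢_; refl; sym; trans; cong; subst; subst₂)

∧-true : ∀ {a b} → a ∧ b ≡ true → T a × T b
∧-true eq = Equivalence.to T-∧ (Equivalence.from T-≡ eq)

∧₃-true : ∀ {a b c} → a ∧ b ∧ c ≡ true → T a × T b × T c
∧₃-true eq = let (ta , tbc) = ∧-true eq in ta , Equivalence.to T-∧ tbc

∧-false : ∀ {a b} → a ∧ b ≡ false → T a → T b → ⊥
∧-false eq ta tb = subst T eq (Equivalence.from T-∧ (ta , tb))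

nth-beyond : ∀ xs q → length xs ≤ q → nth xs q ≡ 0
nth-beyond []       q       _       = refl
nth-beyond (x ∷ xs) (suc q) (s≤s h) = nth-beyond xs q h

nth-at-length : ∀ xs {q} → length xs ≡ q → nth xs q ≡ 0
nth-at-length xs refl = nth-beyond xs (length xs) ≤-refl

nth-nonzero : ∀ xs q → All (1 ≤_) xs → q < length xs → nth xs q ≢ 0
nth-nonzero (x ∷ xs) zero    (() ∷ _) _       refl
nth-nonzero (x ∷ xs) (suc q) (_ ∷ ps) (s≤s h) = nth-nonzero xs q ps h

last-index : ∀ (xs : List ℕ) {q} → length xs ≡ suc q → q < length xs
last-index xs {q} eq = subst (q <_) (sym eq) ≤-refl

setAt-length : ∀ xs p v → length (setAt xs p v) ≡ length xs
setAt-length []       p       v = refl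
setAt-length (x ∷ xs) zero    v = refl
setAt-length (x ∷ xs) (suc p) v = cong suc (setAt-length xs p v)

setAt-before : ∀ xs p v q → q < p → nth (setAt xs p v) q ≡ nth xs q
setAt-before []       p       v q       _       = refl
setAt-before (x ∷ xs) (suc p) v zero    _       = refl
setAt-before (x ∷ xs) (suc p) v (suc q) (s≤s h) = setAt-before xs p v q h

setAt-positive : ∀ xs p v → 1 ≤ v → All (1 ≤_) xs → All (1 ≤_) (setAt xs p v)
setAt-positive []       p       v _   []       = []
setAt-positive (x ∷ xs) zero    v 1≤v (_ ∷ ps) = 1≤v ∷ ps
setAt-positive (x ∷ xs) (suc p) v 1≤v (q ∷ ps) = q ∷ setAt-positive xs p v 1≤v ps

length-snoc : ∀ (xs : List ℕ) v → length (xs ++ [ v ]) ≡ suc (length xs)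
length-snoc xs v = trans (length-++ xs) (+-comm (length xs) 1)

lookupRow : ∀ {P : Row → Set} xs j → All P xs → j < length xs → P (rowAt xs j)
lookupRow (x ∷ xs) zero    (p ∷ _)  _       = p
lookupRow (x ∷ xs) (suc j) (_ ∷ ps) (s≤s h) = lookupRow xs j ps h

all-fromIndices : ∀ {P : Row → Set} xs →
  (∀ j → j < length xs → P (rowAt xs j)) → All P xs
all-fromIndices []       h = []
all-fromIndices (x ∷ xs) h = h 0 (s≤s z≤n) ∷ all-fromIndices xs (λ j hj → h (suc j) (s≤s hj))

allPairs-fromIndices : ∀ {P : Row → Row → Set} xs →
  (∀ i j → i < j → j < length xs → P (rowAt xs i) (rowAt xs j)) → AllPairs P xs
allPairs-fromIndices []       _ = []
allPairs-fromIndices (x ∷ xs) h =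
  all-fromIndices xs (λ j hj → h 0 (suc j) (s≤s z≤n) (s≤s hj))
  ∷ allPairs-fromIndices xs (λ i j i<j hj → h (suc i) (suc j) (s≤s i<j) (s≤s hj))

linked-fromIndices : ∀ {P : Row → Row → Set} xs →
  (∀ i → suc i < length xs → P (rowAt xs i) (rowAt xs (suc i))) → Linked P xs
linked-fromIndices []           _ = []
linked-fromIndices (x ∷ [])     _ = [-]
linked-fromIndices (x ∷ y ∷ xs) h =
  h 0 (s≤s (s≤s z≤n)) ∷ linked-fromIndices (y ∷ xs) (λ i hi → h (suc i) (s≤s hi))

TripleAt : ℕ → Row → Row → Set
TripleAt c x y = nth y (suc c) ≢ 0 → nth x (suc c) ≤ nth y (suc c) → nth x c < nth y (suc c)

Positive : Tab → Set
Positive = All (All (1 ≤_))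

FirstColLt : Row → Row → Set
FirstColLt x y = nth x 0 < nth y 0

LastBelow : ℕ → ℕ → Tab → Set
LastBelow c v = All (λ y → length y ≡ suc c → nth y c < v)

Separated : Tab × ℕ → Set
Separated res = ∀ r → proj₂ res < r → r < length (proj₁ res) →
  rowLen (proj₁ res) (proj₂ res) ≢ rowLen (proj₁ res) r

record Agree (c : ℕ) (x x' : Row) : Set where
  constructor agree
  field at : ∀ q → q ≤ c → nth x' q ≡ nth x q
open Agree

Origin : ℕ → ℕ → ℕ → Tab → Set
Origin c w v T = w ≡ v ⊎ Any (λ s → suc c < length s × w ≡ nth s (suc c)) T

AfterColumn : ℕ → ℕ → Tab → ScanResult → Set
AfterColumn c v T (inj₁ res)      = Separated res
AfterColumn c v T (inj₂ (T' , w)) =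
  LastBelow c w T' × Positive T' × Pointwise (Agree c) T T' × Origin c w v T

separated-cons : ∀ row res → Separated res → Separated (row ∷ proj₁ res , suc (proj₂ res))
separated-cons row res sep (suc r) (s≤s i<r) (s≤s r<n) = sep r i<r r<n

triple-short-row : ∀ c x y → TripleAt c x y → length x ≡ suc c →
  nth y (suc c) ≢ 0 → nth x c < nth y (suc c)
triple-short-row c x y t len nz =
  t nz (subst (_≤ nth y (suc c)) (sym (nth-at-length x len)) z≤n)

placed-separated : ∀ c v row rest → length row ≡ suc c → v ≤ nth row c →
  All (TripleAt c row) rest → Positive rest → LastBelow (suc c) v rest →
  Separated ((row ++ [ v ]) ∷ rest , 0)
placed-separated c v row rest len v≤ triples pos below (suc r) _ (s≤s r<n) same =
  <-irrefl refl (≤-trans (<-trans row<y (lookupRow rest r below r<n ly)) v≤)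
  where
  y = rowAt rest r
  ly : length y ≡ suc (suc c)
  ly = trans (sym same) (trans (length-snoc row v) (cong suc len))
  row<y : nth row c < nth y (suc c)
  row<y = triple-short-row c row y (lookupRow rest r triples r<n) len
            (nth-nonzero y (suc c) (lookupRow rest r pos r<n) (last-index y ly))

bumped-bound : ∀ c v row rest → All (TripleAt c row) rest → Positive rest →
  LastBelow (suc c) v rest → v ≤ nth row c → LastBelow (suc c) (nth row (suc c)) rest
bumped-bound c v row []       []       []       []       _  = []
bumped-bound c v row (y ∷ ys) (t ∷ ts) (p ∷ ps) (b ∷ bs) v≤ =
  bound ∷ bumped-bound c v row ys ts ps bs v≤
  where
  bound : length y ≡ suc (suc c) → nth y (suc c) < nth row (suc c)
  bound ly = ≰⇒> λ row≤y →
    <-irrefl refl (≤-trans (<-trans (t (nth-nonzero y (suc c) p (last-index y ly)) row≤y) (b ly)) v≤)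

passed-bound : ∀ c v w row rest → length row ≡ suc c → nth row c < v →
  All (TripleAt c row) rest → Positive rest → Origin c w v rest → nth row c < w
passed-bound c v w row rest len row<v triples pos (inj₁ refl) = row<v
passed-bound c v w row rest len row<v triples pos (inj₂ bumpedFrom)
  with All.lookupAny (All.zip (triples , pos)) bumpedFrom
... | (t , p) , (long , w≡) =
  subst (nth row c <_) (sym w≡) (triple-short-row c row s t len (nth-nonzero s (suc c) p long))
  where
  s = Any.lookup bumpedFrom

bump-continues : ∀ c v row rest T' w → suc c < length row → nth row (suc c) < v →
  All (1 ≤_) row → AfterColumn c (nth row (suc c)) rest (inj₂ (T' , w)) →
  AfterColumn c v (row ∷ rest) (inj₂ (setAt row (suc c) v ∷ T' , w))
bump-continues c v row rest T' w long bumped<v prow (below , pos , agreeing , origin) =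
  endsLater ∷ below
  , setAt-positive row (suc c) v (≤-trans (s≤s z≤n) bumped<v) prow ∷ pos
  , agree (λ q q≤c → setAt-before row (suc c) v q (s≤s q≤c)) ∷ agreeing
  , fromHere origin
  where
  endsLater : length (setAt row (suc c) v) ≡ suc c → nth (setAt row (suc c) v) c < w
  endsLater eq = ⊥-elim (<-irrefl (trans (sym eq) (setAt-length row (suc c) v)) long)
  fromHere : Origin c w (nth row (suc c)) rest → Origin c w v (row ∷ rest)
  fromHere (inj₁ w≡) = inj₂ (here (long , w≡))
  fromHere (inj₂ a)  = inj₂ (there a)

pass-continues : ∀ c v row rest T' w → (length row ≡ suc c → nth row c < v) →
  All (TripleAt c row) rest → All (1 ≤_) row → Positive rest →
  AfterColumn c v rest (inj₂ (T' , w)) → AfterColumn c v (row ∷ rest) (inj₂ (row ∷ T' , w))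
pass-continues c v row rest T' w row<v triples prow prest (below , pos , agreeing , origin) =
  (λ len → passed-bound c v w row rest len (row<v len) triples prest origin) ∷ below
  , prow ∷ pos
  , agree (λ _ _ → refl) ∷ agreeing
  , later origin
  where
  later : Origin c w v rest → Origin c w v (row ∷ rest)
  later (inj₁ w≡) = inj₁ w≡
  later (inj₂ a)  = inj₂ (there a)

scanCol-correct : ∀ c v T → AllPairs (TripleAt c) T → Positive T → LastBelow (suc c) v T →
  AfterColumn c v T (scanCol (suc (suc c)) v T)
scanCol-correct c v [] _ _ _ = [] , [] , [] , inj₁ refl
scanCol-correct c v (row ∷ rest) (triples ∷ tps) (prow ∷ pos) (_ ∷ below)
  with (length row ≡ᵇ suc c) ∧ (v ≤ᵇ nth row c) in stop?
... | true =
  let (len , v≤) = ∧-true stop?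
  in placed-separated c v row rest (≡ᵇ⇒≡ _ _ len) (≤ᵇ⇒≤ _ _ v≤) triples pos below
... | false
  with (suc (suc c) ≤ᵇ length row) ∧ (nth row (suc c) <ᵇ v) ∧ (v ≤ᵇ nth row c) in bump?
... | true
  with ∧₃-true bump?
... | long , bumped<v , v≤
  with scanCol (suc (suc c)) (nth row (suc c)) rest
     | scanCol-correct c (nth row (suc c)) rest tps pos
         (bumped-bound c v row rest triples pos below (≤ᵇ⇒≤ _ _ v≤))
... | inj₁ res       | sep  = separated-cons (setAt row (suc c) v) res sep
... | inj₂ (T' , w)  | next =
  bump-continues c v row rest T' w (≤ᵇ⇒≤ _ _ long) (<ᵇ⇒< _ _ bumped<v) prow next
scanCol-correct c v (row ∷ rest) (triples ∷ tps) (prow ∷ pos) (_ ∷ below) | false | false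
  with scanCol (suc (suc c)) v rest | scanCol-correct c v rest tps pos below
... | inj₁ res       | sep  = separated-cons row res sep
... | inj₂ (T' , w)  | next = pass-continues c v row rest T' w row<v triples prow pos next
  where
  row<v : length row ≡ suc c → nth row c < v
  row<v len = ≰⇒> λ v≤ → ∧-false stop? (≡⇒≡ᵇ _ _ len) (≤⇒≤ᵇ v≤)

newRow-separated : ∀ v T → AllPairs FirstColLt T → LastBelow 0 v T → Separated (insertNewRow v T)
newRow-separated v []           _           _            (suc r) _ (s≤s ())
newRow-separated v (row ∷ rest) (fc ∷ fcs) (b ∷ below) with nth row 0 <ᵇ v in before?
... | true  = separated-cons row (insertNewRow v rest) (newRow-separated v rest fcs below)
... | false = separated
  where
  v≤row : v ≤ nth row 0
  v≤row = ≮⇒≥ λ row<v → subst T before? (<⇒<ᵇ row<v)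
  separated : Separated ([ v ] ∷ row ∷ rest , 0)
  separated (suc zero)    _ _           same = <-irrefl refl (≤-trans (b (sym same)) v≤row)
  separated (suc (suc r)) _ (s≤s (s≤s r<n)) same =
    <-irrefl refl (≤-trans (<-trans (lookupRow rest r fc r<n) (lookupRow rest r below r<n (sym same))) v≤row)

RespectsAgree : ℕ → (Row → Row → Set) → Set
RespectsAgree c P = ∀ {x x' y y'} → Agree c x x' → Agree c y y' → P x y → P x' y'

allPairs-transport : ∀ {c} {P : Row → Row → Set} → RespectsAgree c P →
  ∀ {T T'} → Pointwise (Agree c) T T' → AllPairs P T → AllPairs P T'
allPairs-transport {c} {P} resp [] [] = []
allPairs-transport {c} {P} resp (ax ∷ axs) (px ∷ pxs) = below ax axs px ∷ allPairs-transport resp axs pxs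
  where
  below : ∀ {x x' ys ys'} → Agree c x x' → Pointwise (Agree c) ys ys' → All (P x) ys → All (P x') ys'
  below ax []         []         = []
  below ax (ay ∷ ays) (p ∷ ps) = resp ax ay p ∷ below ax ays ps

triple-respects : ∀ {c k} → k < c → RespectsAgree c (TripleAt k)
triple-respects {c} {k} k<c ax ay t nz x≤y =
  subst₂ _<_ (sym (at ax k (<⇒≤ k<c))) (sym (at ay (suc k) k<c))
    (t (λ y≡0 → nz (trans (at ay (suc k) k<c) y≡0))
       (subst₂ _≤_ (at ax (suc k) k<c) (at ay (suc k) k<c) x≤y))

firstCol-respects : ∀ {c} → RespectsAgree c FirstColLt
firstCol-respects ax ay lt = subst₂ _<_ (sym (at ax 0 z≤n)) (sym (at ay 0 z≤n)) lt

scanCols-separated : ∀ m v T → (∀ k → k < m → AllPairs (TripleAt k) T) → Positive T →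
  AllPairs FirstColLt T → LastBelow m v T → Separated (scanCols m v T)
scanCols-separated zero    v T _       _   fc below = newRow-separated v T fc below
scanCols-separated (suc m) v T triples pos fc below
  with scanCol (suc (suc m)) v T | scanCol-correct m v T (triples m ≤-refl) pos below
... | inj₁ res       | sep = sep
... | inj₂ (T' , w) | (below' , pos' , agreeing , _) =
  scanCols-separated m w T'
    (λ k k<m → allPairs-transport (triple-respects k<m) agreeing (triples k (m<n⇒m<1+n k<m)))
    pos' (allPairs-transport firstCol-respects agreeing fc) below'

rows-bounded : ∀ T → All (λ y → length y ≤ maxLen T) T
rows-bounded []       = []
rows-bounded (x ∷ xs) = m≤m⊔n (length x) (maxLen xs)
  ∷ All.map (λ h → ≤-trans h (m≤n⊔m (length x) (maxLen xs))) (rows-bounded xs)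

-- The triple rule of a ComT holds in every column c+1; beyond maxLen both
-- sides are vacuous since every entry there is 0.
comT-triples : ∀ {D} → IsComT D → ∀ c → AllPairs (TripleAt c) D
comT-triples {D} comT c = allPairs-fromIndices D triple
  where
  triple : ∀ i j → i < j → j < length D → TripleAt c (rowAt D i) (rowAt D j)
  triple i j i<j j<n nz with suc c <? maxLen D
  ... | yes inside  = IsComT.tripleRule comT i j c i<j j<n inside nz
  ... | no  outside = ⊥-elim (nz (nth-beyond (rowAt D j) (suc c)
                        (≤-trans (lookupRow D j (rows-bounded D) j<n) (≮⇒≥ outside))))

comT-firstColumn : ∀ {D} → IsComT D → AllPairs FirstColLt D
comT-firstColumn {D} comT =
  Linked⇒AllPairs <-trans (linked-fromIndices D (IsComT.firstColStrictlyIncreasing comT))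

-- At the start no row ends in column maxLen, so LastBelow holds for any value.
nothing-beyond-max : ∀ D v → LastBelow (maxLen D) v D
nothing-beyond-max D v =
  All.map (λ bounded eq → ⊥-elim (1+n≰n (subst (_≤ maxLen D) eq bounded))) (rows-bounded D)

lemma6p13 : (D : Tab) (k : ℕ) → IsComT D → 1 ≤ k →
    ∀ r → proj₂ (skylineInsert k D) < r → r < length (proj₁ (skylineInsert k D)) →
    rowLen (proj₁ (skylineInsert k D)) (proj₂ (skylineInsert k D))
      ≢ rowLen (proj₁ (skylineInsert k D)) r
lemma6p13 D k comT _ =
  scanCols-separated (maxLen D) k D (λ c _ → comT-triples comT c)
    (IsComT.positive comT) (comT-firstColumn comT) (nothing-beyond-max D k)
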